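{- Let $(\mathsf P,\mathcal O)$ be a semitopology, let $\mathsf{Val}$ be a set with at least two elements equipped with the discrete semitopology, and let $T\subseteq\mathsf P$. Suppose that for every $p,p'\in T$ and every function $f:\mathsf P\to\mathsf{Val}$, if $f$ is continuous at $p$ and at $p'$ then $f(p)=f(p')$. Then $T$ is transitive.
   Context: A semitopology $(\mathsf P,\mathcal O)$ consists of a set $\mathsf P$ and a family $\mathcal O\subseteq\mathcal P(\mathsf P)$ of open sets with $\varnothing,\mathsf P\in\mathcal O$, closed under arbitrary unions (not necessarily under intersections). Write $X\between Y$ when $X\cap Y\neq\varnothing$. $T\subseteq\mathsf P$ is transitive when for all $O,O'\in\mathcal O$, $O\between T\between O'$ (i.e. $O\between T$ and $T\between O'$) implies $O\between O'$. A function $f:\mathsf P\to\mathsf P'$ between semitopologies is continuous at $p$ when for every open $O'\ni f(p)$ there is an open $O\ni p$ with $O\subseteq f^{ -1}(O')$. -}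

module Defs where

open import Data.Product using (Σ; ∃; _×_; _,_)
open import Data.Empty using (⊥)
open import Data.Unit using (⊤)
open import Data.Bool using (Bool; true; false; _∨_)
open import Relation.Nullary using (¬_)
open import Relation.Binary.PropositionalEquality using (_≡_)

-- Subsets of a carrier as characteristic functions (classical power set,
-- membership x ∈ X is  X x ≡ true).
Subset : Set → Set
Subset A = A → Bool

_∈_ : {A : Set} → A → Subset A → Set
a ∈ X = X a ≡ true

_⊆_ : {A : Set} → Subset A → Subset A → Set
X ⊆ Y = ∀ {a} → a ∈ X → a ∈ Y

_≬_ : {A : Set} → Subset A → Subset A → Set
X ≬ Y = ¬ (∀ a → a ∈ X → a ∈ Y → ⊥)

∅ : {A : Set} → Subset A
∅ _ = false

Full : {A : Set} → Subset A
Full _ = true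

IsUnion : {A I : Set} → (I → Subset A) → Subset A → Set
IsUnion {A} {I} F U = ∀ (a : A) → (a ∈ U → Σ I λ i → a ∈ F i) × (∀ i → a ∈ F i → a ∈ U)

-- Semitopology: open sets contain ∅ and the whole space and are closed under
-- arbitrary (indexed) unions; no closure under intersections.
-- Open sets are identified extensionally: isOpen respects set equality.
record Semitopology (P : Set) : Set₁ where
  field
    isOpen      : Subset P → Set
    open-∅      : isOpen ∅
    open-full   : isOpen Full
    open-⋃      : ∀ {I : Set} (F : I → Subset P) (U : Subset P) →
                  IsUnion F U → (∀ i → isOpen (F i)) → isOpen U

discrete : (V : Set) → Semitopology V
discrete V = record
  { isOpen = λ _ → ⊤
  ; open-∅ = _
  ; open-full = _
  ; open-⋃ = λ _ _ _ _ → _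
  }

Transitive : {P : Set} → Semitopology P → Subset P → Set
Transitive {P} S T = ∀ (O O' : Subset P) → isOpen O → isOpen O' →
                     O ≬ T → T ≬ O' → O ≬ O'
  where open Semitopology S

_⁻¹[_] : {A B : Set} → (A → B) → Subset B → Subset A
(f ⁻¹[ Y ]) a = Y (f a)

ContinuousAt : {P P' : Set} → Semitopology P → Semitopology P' → (P → P') → P → Set
ContinuousAt {P} {P'} S S' f p =
  ∀ (O' : Subset P') → Semitopology.isOpen S' O' → f p ∈ O' →
  Σ (Subset P) λ O → Semitopology.isOpen S O × p ∈ O × (O ⊆ (f ⁻¹[ O' ]))

AtLeastTwo : Set → Set
AtLeastTwo V = Σ V λ v → Σ V λ w → ¬ (v ≡ w)

-- If O and O' were disjoint open sets meeting T at p and p', the function that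
-- is w on O' and v elsewhere would be constant on each of O and O', hence
-- continuous at p and at p'; the hypothesis then forces v = w.
module Submission where

open import Defs
open import Data.Bool using (true; false; if_then_else_)
open import Data.Empty using (⊥; ⊥-elim)
open import Data.Product using (_,_)
open import Relation.Binary.PropositionalEquality using (_≡_; refl; sym; subst; module ≡-Reasoning)
open ≡-Reasoning

indicator : {A V : Set} → Subset A → V → V → A → V
indicator X outside inside a = if X a then inside else outside

module _ {A V : Set} {X : Subset A} {outside inside : V} where

  indicator-∈ : ∀ {a} → a ∈ X → indicator X outside inside a ≡ inside
  indicator-∈ a∈X rewrite a∈X = refl

  indicator-disjoint : {Y : Subset A} → (∀ a → a ∈ Y → a ∈ X → ⊥) →
                       ∀ {a} → a ∈ Y → indicator X outside inside a ≡ outside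
  indicator-disjoint Y∩X=∅ {a} a∈Y with X a in a∈X?
  ... | false = refl
  ... | true  = ⊥-elim (Y∩X=∅ a a∈Y a∈X?)

continuousAt-discrete-if-constant-on-open :
  {P V : Set} (S : Semitopology P) (f : P → V) (O : Subset P) →
  Semitopology.isOpen S O → (∀ {x y} → x ∈ O → y ∈ O → f x ≡ f y) →
  ∀ {p} → p ∈ O → ContinuousAt S (discrete V) f p
continuousAt-discrete-if-constant-on-open S f O open-O constant p∈O U _ fp∈U =
  O , open-O , p∈O , λ x∈O → subst (_∈ U) (constant p∈O x∈O) fp∈U

proposition3p7 : {P : Set} (S : Semitopology P) (Val : Set) → AtLeastTwo Val →
                 (T : Subset P) →
                 (∀ (p p' : P) → p ∈ T → p' ∈ T → (f : P → Val) →
                    ContinuousAt S (discrete Val) f p →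
                    ContinuousAt S (discrete Val) f p' → f p ≡ f p') →
                 Transitive S T
proposition3p7 {P} S Val (v , w , v≢w) T sameValue O O' open-O open-O' O≬T T≬O' O∩O'=∅ =
  O≬T λ p p∈O p∈T → T≬O' λ p' p'∈T p'∈O' → v≢w (begin
    v     ≡⟨ sym (f-on-O p∈O) ⟩
    f p   ≡⟨ sameValue p p' p∈T p'∈T f (continuous-on-O p∈O) (continuous-on-O' p'∈O') ⟩
    f p'  ≡⟨ f-on-O' p'∈O' ⟩
    w     ∎)
  where
  f : P → Val
  f = indicator O' v w

  f-on-O : ∀ {x} → x ∈ O → f x ≡ v
  f-on-O = indicator-disjoint O∩O'=∅

  f-on-O' : ∀ {x} → x ∈ O' → f x ≡ w
  f-on-O' = indicator-∈ {X = O'}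

  continuous-on-O : ∀ {p} → p ∈ O → ContinuousAt S (discrete Val) f p
  continuous-on-O = continuousAt-discrete-if-constant-on-open S f O open-O
    λ x∈O y∈O → begin _ ≡⟨ f-on-O x∈O ⟩ v ≡⟨ sym (f-on-O y∈O) ⟩ _ ∎

  continuous-on-O' : ∀ {p} → p ∈ O' → ContinuousAt S (discrete Val) f p
  continuous-on-O' = continuousAt-discrete-if-constant-on-open S f O' open-O'
    λ x∈O' y∈O' → begin _ ≡⟨ f-on-O' x∈O' ⟩ w ≡⟨ sym (f-on-O' y∈O') ⟩ _ ∎
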